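{- Let $G=(V,E)$ be a connected $(K_4,\text{diamond},\text{butterfly})$-free graph, let $xy\in E$ and $r\in V$ with $rx\in E$, $ry\notin E$. For $i\ge1$ let $N_i=\{z\in V:\mathrm{dist}_G(z,xy)=i\}$, and assume $N_1$ and $N_2$ are independent sets; write $N_2=\{u_1,\dots,u_k\}$. For each $i$, let $T_i$ be the set of vertices $t\in N_3$ whose only neighbor in $N_2$ is $u_i$. Let $Y=V\setminus(\{x,y\}\cup N_1\cup N_2\cup N_3)$. Suppose $z\in N_4$ has no neighbor in $Y$, and $z$ is adjacent to some $t_i\in T_i$. Then every dominating induced matching $M$ of $G$ with $xy\in M$ contains the edge $u_it_i$. Moreover, if $|N(z)\cap T_i|\ge 2$, then $G$ has no dominating induced matching containing $xy$.
   Context: A dominating induced matching of $G$ is a set $M\subseteq E$ such that every edge of $G$ shares at least one vertex with exactly one edge of $M$. $\mathrm{dist}_G(z,xy)=\min\{\mathrm{dist}_G(z,x),\mathrm{dist}_G(z,y)\}$. A diamond is $K_4$ minus one edge; a butterfly consists of two disjoint edges $v_1v_2$, $v_3v_4$ (no edges between them) plus a vertex adjacent to all four. -}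

module Defs where

open import Data.Nat using (ℕ; zero; suc; _<_)
open import Data.Fin using (Fin)
open import Data.Bool using (Bool; true; false)
open import Data.Product using (Σ; ∃; _×_; _,_)
open import Data.Sum using (_⊎_)
open import Data.Empty using (⊥)
open import Relation.Nullary using (¬_)
open import Relation.Binary.PropositionalEquality using (_≡_; _≢_)

record Graph (n : ℕ) : Set where
  field
    adj    : Fin n → Fin n → Bool
    sym    : ∀ u v → adj u v ≡ adj v u
    irrefl : ∀ u → adj u u ≡ false

open Graph public

module _ {n : ℕ} (G : Graph n) where

  V : Set
  V = Fin n

  Edge : V → V → Set
  Edge u v = adj G u v ≡ true

  Reach : ℕ → V → V → Set
  Reach zero u v = u ≡ v
  Reach (suc k) u v = Σ V λ w → Edge u w × Reach k w v

  Dist : V → V → ℕ → Set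
  Dist u v i = Reach i u v × (∀ j → j < i → ¬ Reach j u v)

  -- dist_G(z, xy) = min(dist(z,x), dist(z,y)) = i
  DistE : V → V → V → ℕ → Set
  DistE z x y i = (Reach i z x ⊎ Reach i z y)
                × (∀ j → j < i → ¬ Reach j z x × ¬ Reach j z y)

  Connected : Set
  Connected = ∀ u v → ∃ λ k → Reach k u v

  K4Free : Set
  K4Free = ∀ a b c d → Edge a b → Edge a c → Edge a d →
           Edge b c → Edge b d → Edge c d → ⊥

  -- diamond-free (no induced diamond = K4 minus the edge cd)
  DiamondFree : Set
  DiamondFree = ∀ a b c d → c ≢ d → Edge a b → Edge a c → Edge a d →
                Edge b c → Edge b d → ¬ Edge c d → ⊥

  ButterflyFree : Set
  ButterflyFree = ∀ v₁ v₂ v₃ v₄ v₅ → Edge v₁ v₂ → Edge v₃ v₄ →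
                  ¬ Edge v₁ v₃ → ¬ Edge v₁ v₄ → ¬ Edge v₂ v₃ → ¬ Edge v₂ v₄ →
                  Edge v₅ v₁ → Edge v₅ v₂ → Edge v₅ v₃ → Edge v₅ v₄ → ⊥

  record EdgeSet : Set where
    field
      mem    : V → V → Bool
      memSym : ∀ u v → mem u v ≡ mem v u
      memE   : ∀ u v → mem u v ≡ true → Edge u v

  open EdgeSet public

  InM : EdgeSet → V → V → Set
  InM M u v = mem M u v ≡ true

  SamePair : V → V → V → V → Set
  SamePair a b c d = (a ≡ c × b ≡ d) ⊎ (a ≡ d × b ≡ c)

  Touch : V → V → V → V → Set
  Touch a b c d = (a ≡ c ⊎ a ≡ d) ⊎ (b ≡ c ⊎ b ≡ d)

  -- M is a dominating induced matching: every edge ab of G shares a vertex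
  -- with exactly one edge of M
  IsDIM : EdgeSet → Set
  IsDIM M = ∀ a b → Edge a b →
            (Σ V λ c → Σ V λ d → InM M c d × Touch a b c d)
            × (∀ c d c' d' → InM M c d → Touch a b c d →
                             InM M c' d' → Touch a b c' d' → SamePair c d c' d')

  Independent : (V → Set) → Set
  Independent S = ∀ u v → S u → S v → ¬ Edge u v

-- Let M be a dominating induced matching with xy ∈ M. Two M-edges never touch
-- a common edge, so a vertex adjacent to an endpoint c of an M-edge cd is either
-- d or unsaturated. Hence N₁ is unsaturated, and N₂ is saturated because its
-- edges to N₁ must be dominated. An N₃-vertex saturated by M is matched into N₂
-- (its N₂-neighbour is saturated), so z ∈ N₄, all of whose neighbours lie in
-- N₃, is unsaturated; the edge zt then forces t to be saturated, and since u is
-- saturated too, ut ∈ M. Two such edges ut, ut' cannot both lie in M.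
module Submission where

open import Defs
open import Data.Nat using (ℕ; suc; _<_; z<s; s<s)
open import Data.Product using (Σ; _×_; _,_; proj₁; proj₂)
open import Data.Sum using (inj₁; inj₂; [_,_]′; _⊎_)
open import Data.Empty using (⊥-elim)
open import Function using (_∘_)
open import Relation.Nullary using (¬_)
open import Relation.Binary.PropositionalEquality as ≡ using (_≡_; _≢_; refl; subst)

module _ {n : ℕ} {G : Graph n} where

  edge-sym : ∀ {a b} → Edge G a b → Edge G b a
  edge-sym {a} {b} e = ≡.trans (sym G b a) e

  edge-irrefl : ∀ {a b} → Edge G a b → a ≢ b
  edge-irrefl {a} e refl with () ← ≡.trans (≡.sym e) (irrefl G a)

  inM-sym : ∀ (M : EdgeSet G) {a b} → InM G M a b → InM G M b a
  inM-sym M {a} {b} m = ≡.trans (memSym M b a) m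

  Saturated : EdgeSet G → V G → Set
  Saturated M v = Σ (V G) (InM G M v)

  module _ {x y : V G} where

    DistE-below : ∀ {z i j} → DistE G z x y i → j < i → ¬ DistE G z x y j
    DistE-below (_ , far) j<i (near , _) = [ proj₁ (far _ j<i) , proj₂ (far _ j<i) ]′ near

    DistE-neighbour-far : ∀ {z s i j} → DistE G z x y i → Edge G z s → suc j < i →
                          ¬ (Reach G j s x ⊎ Reach G j s y)
    DistE-neighbour-far {s = s} (_ , far) e sj<i (inj₁ r) = proj₁ (far _ sj<i) (s , e , r)
    DistE-neighbour-far {s = s} (_ , far) e sj<i (inj₂ r) = proj₂ (far _ sj<i) (s , e , r)

    DistE-neighbour-pred : ∀ {u v i} → DistE G u x y (suc i) → Edge G u v →
                           (Reach G i v x ⊎ Reach G i v y) → DistE G v x y i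
    DistE-neighbour-pred du e near =
      near , λ j j<i → let far = DistE-neighbour-far du e (s<s j<i) in far ∘ inj₁ , far ∘ inj₂

    DistE-pred : ∀ {u i} → DistE G u x y (suc i) → Σ (V G) λ v → Edge G u v × DistE G v x y i
    DistE-pred du@(inj₁ (v , e , r) , _) = v , e , DistE-neighbour-pred du e (inj₁ r)
    DistE-pred du@(inj₂ (v , e , r) , _) = v , e , DistE-neighbour-pred du e (inj₂ r)

  module _ (M : EdgeSet G) (dim : IsDIM G M) where

    adjacent-saturated≡partner : ∀ {a c d} → InM G M c d → Edge G a c → Saturated M a → a ≡ d
    adjacent-saturated≡partner {a} {c} {d} m e (a' , ma)
      with proj₂ (dim a c e) a a' c d ma (inj₁ (inj₁ refl)) m (inj₂ (inj₁ refl))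
    ... | inj₁ (a≡c , _) = ⊥-elim (edge-irrefl e a≡c)
    ... | inj₂ (a≡d , _) = a≡d

    partner-unique : ∀ {a b c} → InM G M a b → InM G M a c → b ≡ c
    partner-unique {a} mab mac = adjacent-saturated≡partner mac (edge-sym (memE M _ _ mab)) (a , inM-sym M mab)

    both-saturated⇒∈M : ∀ {a b} → Edge G a b → Saturated M a → Saturated M b → InM G M a b
    both-saturated⇒∈M {b = b} e sa (d , mb) =
      inM-sym M (subst (InM G M b) (≡.sym (adjacent-saturated≡partner mb e sa)) mb)

    edge-dominated : ∀ {a b} → Edge G a b → ¬ Saturated M b → Saturated M a
    edge-dominated {a} {b} e ¬sb with proj₁ (dim a b e)
    ... | c , d , m , inj₁ (inj₁ refl) = d , m
    ... | c , d , m , inj₁ (inj₂ refl) = c , inM-sym M m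
    ... | c , d , m , inj₂ (inj₁ refl) = ⊥-elim (¬sb (d , m))
    ... | c , d , m , inj₂ (inj₂ refl) = ⊥-elim (¬sb (c , inM-sym M m))

    module _ {x y : V G} (mxy : InM G M x y) where

      N₁-unsaturated : ∀ {v} → DistE G v x y 1 → ¬ Saturated M v
      N₁-unsaturated (inj₁ (_ , evx , refl) , far) sv =
        proj₂ (far 0 z<s) (adjacent-saturated≡partner mxy evx sv)
      N₁-unsaturated (inj₂ (_ , evy , refl) , far) sv =
        proj₁ (far 0 z<s) (adjacent-saturated≡partner (inM-sym M mxy) evy sv)

      N₂-saturated : ∀ {u} → DistE G u x y 2 → Saturated M u
      N₂-saturated du with v , euv , dv ← DistE-pred du = edge-dominated euv (N₁-unsaturated dv)

      N₃-partner-in-N₂ : ∀ {s z} → DistE G s x y 3 → InM G M s z → DistE G z x y 2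
      N₃-partner-in-N₂ ds msz with w , esw , dw ← DistE-pred ds =
        subst (λ w → DistE G w x y 2)
              (adjacent-saturated≡partner msz (edge-sym esw) (N₂-saturated dw)) dw

      N₄-unsaturated : ∀ {z} → DistE G z x y 4 →
        (∀ w → w ≢ x → w ≢ y → ¬ DistE G w x y 1 → ¬ DistE G w x y 2 →
           ¬ DistE G w x y 3 → ¬ Edge G z w) →
        ¬ Saturated M z
      N₄-unsaturated {z} dz outside-N₃ (s , mzs) =
        outside-N₃ s (far 0 (s<s z<s) ∘ inj₁) (far 0 (s<s z<s) ∘ inj₂)
          (far 1 (s<s (s<s z<s)) ∘ proj₁) (far 2 (s<s (s<s (s<s z<s))) ∘ proj₁)
          (λ ds → DistE-below dz (s<s (s<s z<s)) (N₃-partner-in-N₂ ds (inM-sym M mzs)))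
          ezs
        where
        ezs : Edge G z s
        ezs = memE M _ _ mzs
        far : ∀ j → suc j < 4 → ¬ (Reach G j s x ⊎ Reach G j s y)
        far j sj<4 = DistE-neighbour-far dz ezs sj<4

proposition1 : ∀ {n : ℕ} (G : Graph n) →
    Connected G → K4Free G → DiamondFree G → ButterflyFree G →
    (x y r : V G) → Edge G x y → Edge G r x → ¬ Edge G r y →
    Independent G (λ w → DistE G w x y 1) →
    Independent G (λ w → DistE G w x y 2) →
    (u t z : V G) →
    DistE G u x y 2 →
    DistE G t x y 3 → Edge G t u → (∀ w → DistE G w x y 2 → Edge G t w → w ≡ u) →
    DistE G z x y 4 →
    (∀ w → w ≢ x → w ≢ y → ¬ DistE G w x y 1 → ¬ DistE G w x y 2 →
    ¬ DistE G w x y 3 → ¬ Edge G z w) →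
    Edge G z t →
    ((M : EdgeSet G) → IsDIM G M → InM G M x y → InM G M u t)
    × ((t' : V G) → t' ≢ t → DistE G t' x y 3 → Edge G t' u →
    (∀ w → DistE G w x y 2 → Edge G t' w → w ≡ u) → Edge G z t' →
    ¬ (Σ (EdgeSet G) λ M → IsDIM G M × InM G M x y))
proposition1 G _ _ _ _ x y _ _ _ _ _ _ u t z du _ etu _ dz outside-N₃ ezt =
  ut∈M etu ezt ,
  λ { t' t'≢t _ et'u _ ezt' (M , dim , mxy) →
        t'≢t (≡.sym (partner-unique M dim (ut∈M etu ezt M dim mxy) (ut∈M et'u ezt' M dim mxy))) }
  where
  ut∈M : ∀ {t} → Edge G t u → Edge G z t →
         (M : EdgeSet G) → IsDIM G M → InM G M x y → InM G M u t
  ut∈M etu ezt M dim mxy =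
    both-saturated⇒∈M M dim (edge-sym {G = G} etu) (N₂-saturated M dim mxy du)
      (edge-dominated M dim (edge-sym {G = G} ezt) (N₄-unsaturated M dim mxy dz outside-N₃))
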